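{- For every hypergraph $\mathcal{H}$ we have $$\tau_2(\mathcal{H})/2\le \mathrm{dec}(\mathcal{H})\le \tau_2(\mathcal{H})-1,$$ and both bounds are tight (each is attained with equality by some hypergraph). In particular, $\tau_2(\mathcal{H})$ is a 2-approximation for $\mathrm{dec}(\mathcal{H})$.
   Context: A hypergraph $\mathcal{H}=(X,\mathcal{E})$ has finite vertex set $X$, $|X|=n$, and edges that are subsets of $X$ of size at least 2. A C-coloring is a map $\varphi:X\to\mathbb{N}$ such that every edge contains two distinct vertices of the same color; $\overline{\chi}(\mathcal{H})$ is the maximum of $|\varphi(X)|$ over C-colorings, and $\mathrm{dec}(\mathcal{H})=n-\overline{\chi}(\mathcal{H})$. A 2-transversal is a set $T\subseteq X$ with $|E\cap T|\ge 2$ for every edge $E$; $\tau_2(\mathcal{H})$ is the minimum size of a 2-transversal. -}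

module Defs where

open import Data.Nat using (ℕ; _≤_; _∸_)
import Data.Nat as ℕ
open import Data.Fin using (Fin)
open import Data.Fin.Subset using (Subset; _∈_; _∩_; ∣_∣)
open import Data.List using (List; length; map; deduplicate)
open import Data.List.Relation.Unary.All using (All)
import Data.List.Membership.Propositional as LM
open import Data.Product using (Σ; ∃; _×_)
open import Relation.Binary.PropositionalEquality using (_≡_; _≢_)
open import Data.List using (allFin)

record Hypergraph : Set where
  field
    n       : ℕ
    edges   : List (Subset n)
    edge≥2  : All (λ E → 2 ≤ ∣ E ∣) edges
open Hypergraph public

IsCColoring : (H : Hypergraph) → (Fin (n H) → ℕ) → Set
IsCColoring H φ = ∀ {E} → E LM.∈ edges H →
  ∃ λ x → ∃ λ y → x ≢ y × x ∈ E × y ∈ E × φ x ≡ φ y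

numColors : ∀ {m} → (Fin m → ℕ) → ℕ
numColors {m} φ = length (deduplicate ℕ._≟_ (map φ (allFin m)))

IsUpperChromatic : Hypergraph → ℕ → Set
IsUpperChromatic H k =
  (Σ (Fin (n H) → ℕ) λ φ → IsCColoring H φ × numColors φ ≡ k)
  × (∀ φ → IsCColoring H φ → numColors φ ≤ k)

IsDec : Hypergraph → ℕ → Set
IsDec H d = Σ ℕ λ k → IsUpperChromatic H k × d ≡ n H ∸ k

Is2Transversal : (H : Hypergraph) → Subset (n H) → Set
Is2Transversal H T = All (λ E → 2 ≤ ∣ E ∩ T ∣) (edges H)

IsTau2 : Hypergraph → ℕ → Set
IsTau2 H t =
  (Σ (Subset (n H)) λ T → Is2Transversal H T × ∣ T ∣ ≡ t)
  × (∀ T → Is2Transversal H T → t ≤ ∣ T ∣)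

-- The paper's hypergraphs have at least one edge (otherwise the upper bound fails).
HasEdge : Hypergraph → Set
HasEdge H = Σ (Subset (n H)) λ E → E LM.∈ edges H

-- Lower bound: in a C-colouring with k colours, the vertices whose colour is repeated
-- form a 2-transversal (each edge has two vertices of equal colour), and a colour class
-- of size s ≥ 2 contributes s ≤ 2(s − 1) of them, so τ₂ ≤ 2(n − k).
-- Upper bound: colouring a 2-transversal T with one colour and every other vertex with
-- its own colour is a C-colouring with n − |T| + 1 colours, so dec ≤ τ₂ − 1.
-- The single edge on two vertices has dec = 1 and τ₂ = 2, attaining both bounds.
module Submission where

open import Defs
open import Data.Nat using (ℕ; _≤_; _<_; _*_; suc)
open import Data.Product using (Σ; _×_)
open import Relation.Binary.PropositionalEquality using (_≡_)

open import Data.Nat using (_+_; _∸_; z≤n; s≤s; >-nonZero)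
import Data.Nat as ℕ
open import Data.Nat.Properties
  using (≤-refl; ≤-trans; ≤-reflexive; n≤1+n; m≤n⇒m≤1+n; suc-injective; +-comm; +-suc; *-suc;
         +-monoˡ-≤; +-monoʳ-≤; *-distribˡ-∸; m+n≤o⇒m≤o∸n; m<n+o⇒m∸n<o; module ≤-Reasoning)
open import Data.Fin using (Fin; zero; suc; toℕ)
open import Data.Fin.Properties using (any?; toℕ-injective)
import Data.Fin.Properties as Fin
open import Data.Fin.Subset
  using (Subset; Side; inside; outside; _∈_; _∪_; ⁅_⁆; ⊤; ∣_∣; Nonempty)
open import Data.Fin.Subset.Properties
  using (_∈?_; x∈p∩q⁺; x∈p∩q⁻; x∈p∪q⁺; x∈⁅x⁆; ∣⁅x⁆∣≡1; ∣p∩q∣≤∣q∣;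
         x∈p⇒∣p-x∣<∣p∣; x∈p∧x≢y⇒x∈p-y)
open import Data.Vec using ([]; _∷_; here; there)
open import Data.List using ([]; _∷_; length; map; filter; deduplicate; allFin)
open import Data.List.Properties using (filter-all; filter-accept; filter-reject; map-tabulate)
open import Data.List.Membership.Propositional using () renaming (_∈_ to _∈ₗ_; _∉_ to _∉ₗ_)
open import Data.List.Membership.Propositional.Properties
  using (∈-deduplicate⁺; ∈-deduplicate⁻; ∈-map⁺; ∈-map⁻; ∈-allFin)
open import Data.List.Relation.Unary.Any using (here; there)
open import Data.List.Relation.Unary.All as All using (All; []; _∷_)
open import Data.List.Relation.Unary.AllPairs using (_∷_)
open import Data.List.Relation.Unary.Unique.Propositional using (Unique)
open import Data.Product using (_,_; ∃; ∃₂; ∄)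
import Data.Product as Product
open import Data.Sum using (inj₁; inj₂)
open import Function using (_∘_; id; case_of_)
open import Level using (0ℓ)
open import Relation.Binary.Definitions using (DecidableEquality)
open import Relation.Binary.PropositionalEquality using (refl; sym; trans; cong; subst; _≢_)
open import Relation.Nullary using (yes; no; ¬?; contradiction)
open import Relation.Unary using (Pred; _⊆_)

private
  variable
    m d t : ℕ
    x y : Fin m
    p : Subset m

module _ {a} {A : Set a} (_≟_ : DecidableEquality A) where
  open import Data.List.Relation.Unary.Unique.DecPropositional.Properties _≟_
    using (deduplicate-!)

  length-filter-≢ : ∀ {x xs} → Unique xs → x ∈ₗ xs →
                    suc (length (filter (¬? ∘ (x ≟_)) xs)) ≡ length xs
  length-filter-≢ {x} {_ ∷ xs} (x∉xs ∷ _) (here refl)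
    rewrite filter-reject (¬? ∘ (x ≟_)) {x} {xs} (λ x≢x → x≢x refl)
          | filter-all (¬? ∘ (x ≟_)) x∉xs = refl
  length-filter-≢ {x} {y ∷ xs} (y∉xs ∷ unique) (there x∈xs)
    rewrite filter-accept (¬? ∘ (x ≟_)) {y} {xs} (λ x≡y → All.lookup y∉xs x∈xs (sym x≡y))
    = cong suc (length-filter-≢ unique x∈xs)

  length-deduplicate-∷-∈ : ∀ {x xs} → x ∈ₗ xs →
                           length (deduplicate _≟_ (x ∷ xs)) ≡ length (deduplicate _≟_ xs)
  length-deduplicate-∷-∈ {xs = xs} x∈xs =
    length-filter-≢ (deduplicate-! xs) (∈-deduplicate⁺ _≟_ x∈xs)

  length-deduplicate-∷-∉ : ∀ {x xs} → x ∉ₗ xs →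
                           length (deduplicate _≟_ (x ∷ xs)) ≡ suc (length (deduplicate _≟_ xs))
  length-deduplicate-∷-∉ {x} {xs} x∉xs = cong (suc ∘ length) (filter-all (¬? ∘ (x ≟_))
    (All.tabulate λ y∈ x≡y → x∉xs (subst (_∈ₗ xs) (sym x≡y) (∈-deduplicate⁻ _≟_ xs y∈))))

map-allFin-suc : ∀ {b} {B : Set b} (f : Fin (suc m) → B) →
                 map f (allFin (suc m)) ≡ f zero ∷ map (f ∘ suc) (allFin m)
map-allFin-suc f = cong (f zero ∷_) (trans (map-tabulate suc f) (sym (map-tabulate id (f ∘ suc))))

numColors-repeated : (φ : Fin (suc m) → ℕ) → φ zero ≡ φ (suc y) →
                     numColors φ ≡ numColors (φ ∘ suc)
numColors-repeated {y = y} φ φ₀≡φy =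
  trans (cong (length ∘ deduplicate ℕ._≟_) (map-allFin-suc φ))
        (length-deduplicate-∷-∈ ℕ._≟_ (subst (_∈ₗ map (φ ∘ suc) (allFin _)) (sym φ₀≡φy)
                                              (∈-map⁺ (φ ∘ suc) (∈-allFin y))))

numColors-fresh : (φ : Fin (suc m) → ℕ) → ∄ (λ y → φ zero ≡ φ (suc y)) →
                  numColors φ ≡ suc (numColors (φ ∘ suc))
numColors-fresh φ fresh =
  trans (cong (length ∘ deduplicate ℕ._≟_) (map-allFin-suc φ))
        (length-deduplicate-∷-∉ ℕ._≟_ {xs = map (φ ∘ suc) (allFin _)} λ φ₀∈ →
           case ∈-map⁻ (φ ∘ suc) φ₀∈ of λ where (y , _ , φ₀≡φy) → fresh (y , φ₀≡φy))

∣p∪q∣≤∣p∣+∣q∣ : (p q : Subset m) → ∣ p ∪ q ∣ ≤ ∣ p ∣ + ∣ q ∣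
∣p∪q∣≤∣p∣+∣q∣ [] [] = z≤n
∣p∪q∣≤∣p∣+∣q∣ (outside ∷ p) (outside ∷ q) = ∣p∪q∣≤∣p∣+∣q∣ p q
∣p∪q∣≤∣p∣+∣q∣ (inside ∷ p) (outside ∷ q) = s≤s (∣p∪q∣≤∣p∣+∣q∣ p q)
∣p∪q∣≤∣p∣+∣q∣ (outside ∷ p) (inside ∷ q) =
  ≤-trans (s≤s (∣p∪q∣≤∣p∣+∣q∣ p q)) (≤-reflexive (sym (+-suc ∣ p ∣ ∣ q ∣)))
∣p∪q∣≤∣p∣+∣q∣ (inside ∷ p) (inside ∷ q) =
  s≤s (≤-trans (m≤n⇒m≤1+n (∣p∪q∣≤∣p∣+∣q∣ p q)) (≤-reflexive (sym (+-suc ∣ p ∣ ∣ q ∣))))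

x∈p⇒0<∣p∣ : x ∈ p → 0 < ∣ p ∣
x∈p⇒0<∣p∣ x∈p = ≤-trans (s≤s z≤n) (x∈p⇒∣p-x∣<∣p∣ x∈p)

x≢y⇒x∈p⇒y∈p⇒2≤∣p∣ : x ≢ y → x ∈ p → y ∈ p → 2 ≤ ∣ p ∣
x≢y⇒x∈p⇒y∈p⇒2≤∣p∣ x≢y x∈p y∈p =
  ≤-trans (s≤s (x∈p⇒0<∣p∣ (x∈p∧x≢y⇒x∈p-y y∈p (x≢y ∘ sym)))) (x∈p⇒∣p-x∣<∣p∣ x∈p)

0<∣p∣⇒Nonempty : 0 < ∣ p ∣ → Nonempty p
0<∣p∣⇒Nonempty {p = inside ∷ p} _ = zero , here
0<∣p∣⇒Nonempty {p = outside ∷ p} 0<∣p∣ = Product.map suc there (0<∣p∣⇒Nonempty 0<∣p∣)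

2≤∣p∣⇒∃≢ : 2 ≤ ∣ p ∣ → ∃₂ λ x y → x ≢ y × x ∈ p × y ∈ p
2≤∣p∣⇒∃≢ {p = inside ∷ p} (s≤s 0<∣p∣) with y , y∈p ← 0<∣p∣⇒Nonempty 0<∣p∣ =
  zero , suc y , (λ ()) , here , there y∈p
2≤∣p∣⇒∃≢ {p = outside ∷ p} 2≤∣p∣ with x , y , x≢y , x∈p , y∈p ← 2≤∣p∣⇒∃≢ 2≤∣p∣ =
  suc x , suc y , x≢y ∘ Fin.suc-injective , there x∈p , there y∈p

Repeated : (Fin m → ℕ) → Pred (Fin m) 0ℓ
Repeated φ x = ∃ λ y → x ≢ y × φ x ≡ φ y

repeated-suc : {φ : Fin (suc m) → ℕ} → Repeated (φ ∘ suc) x → Repeated φ (suc x)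
repeated-suc (y , x≢y , φx≡φy) = suc y , x≢y ∘ Fin.suc-injective , φx≡φy

⊆-tail : {φ : Fin (suc m) → ℕ} {b : Side} {T : Subset m} →
         Repeated φ ⊆ (_∈ b ∷ T) → Repeated (φ ∘ suc) ⊆ (_∈ T)
⊆-tail cover r with there x∈T ← cover (repeated-suc r) = x∈T

zero-fresh : {φ : Fin (suc m) → ℕ} {T : Subset m} →
             Repeated φ ⊆ (_∈ outside ∷ T) → ∄ λ y → φ zero ≡ φ (suc y)
zero-fresh cover (y , φ₀≡φy) with () ← cover {zero} (suc y , (λ ()) , φ₀≡φy)

-- A repeated first colour is charged to vertex 0 and one partner j, costing 2 vertices of S
-- but no colour; a fresh first colour costs one colour and no vertex.
repeated-cover : (φ : Fin m → ℕ) →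
                 ∃ λ S → Repeated φ ⊆ (_∈ S) × ∣ S ∣ + 2 * numColors φ ≤ 2 * m
repeated-cover {ℕ.zero} φ = [] , (λ { {()} }) , z≤n
repeated-cover {suc m} φ with S , cover , bound ← repeated-cover (φ ∘ suc)
                           | any? (λ y → φ zero ℕ.≟ φ (suc y))
... | yes (j , φ₀≡φj) = inside ∷ (S ∪ ⁅ j ⁆) , cover′ , bound′
  where
  cover′ : Repeated φ ⊆ (_∈ inside ∷ (S ∪ ⁅ j ⁆))
  cover′ {zero} _ = here
  cover′ {suc x} (zero , _ , φx≡φ₀) with x Fin.≟ j
  ... | yes refl = there (x∈p∪q⁺ (inj₂ (x∈⁅x⁆ x)))
  ... | no x≢j = there (x∈p∪q⁺ (inj₁ (cover (j , x≢j , trans φx≡φ₀ φ₀≡φj))))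
  cover′ {suc x} (suc y , x≢y , φx≡φy) =
    there (x∈p∪q⁺ (inj₁ (cover (y , x≢y ∘ cong suc , φx≡φy))))
  open ≤-Reasoning
  bound′ : suc ∣ S ∪ ⁅ j ⁆ ∣ + 2 * numColors φ ≤ 2 * suc m
  bound′ = begin
    suc ∣ S ∪ ⁅ j ⁆ ∣ + 2 * numColors φ
      ≡⟨ cong (λ c → suc ∣ S ∪ ⁅ j ⁆ ∣ + 2 * c) (numColors-repeated φ φ₀≡φj) ⟩
    suc ∣ S ∪ ⁅ j ⁆ ∣ + 2 * numColors (φ ∘ suc)
      ≤⟨ +-monoˡ-≤ (2 * numColors (φ ∘ suc)) (s≤s ∣S∪⁅j⁆∣≤1+∣S∣) ⟩
    2 + (∣ S ∣ + 2 * numColors (φ ∘ suc))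
      ≤⟨ s≤s (s≤s bound) ⟩
    2 + 2 * m
      ≡⟨ sym (*-suc 2 m) ⟩
    2 * suc m ∎
    where
    ∣S∪⁅j⁆∣≤1+∣S∣ : ∣ S ∪ ⁅ j ⁆ ∣ ≤ suc ∣ S ∣
    ∣S∪⁅j⁆∣≤1+∣S∣ = ≤-trans (∣p∪q∣≤∣p∣+∣q∣ S ⁅ j ⁆)
                            (≤-reflexive (trans (cong (∣ S ∣ +_) (∣⁅x⁆∣≡1 j)) (+-comm ∣ S ∣ 1)))
... | no fresh = outside ∷ S , cover′ , bound′
  where
  cover′ : Repeated φ ⊆ (_∈ outside ∷ S)
  cover′ {zero} (zero , 0≢0 , _) = contradiction refl 0≢0
  cover′ {zero} (suc y , _ , φ₀≡φy) = contradiction (y , φ₀≡φy) fresh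
  cover′ {suc x} (zero , _ , φx≡φ₀) = contradiction (x , sym φx≡φ₀) fresh
  cover′ {suc x} (suc y , x≢y , φx≡φy) = there (cover (y , x≢y ∘ cong suc , φx≡φy))
  open ≤-Reasoning
  bound′ : ∣ S ∣ + 2 * numColors φ ≤ 2 * suc m
  bound′ = begin
    ∣ S ∣ + 2 * numColors φ
      ≡⟨ cong (λ c → ∣ S ∣ + 2 * c) (numColors-fresh φ fresh) ⟩
    ∣ S ∣ + 2 * suc (numColors (φ ∘ suc))
      ≡⟨ cong (∣ S ∣ +_) (*-suc 2 (numColors (φ ∘ suc))) ⟩
    ∣ S ∣ + (2 + 2 * numColors (φ ∘ suc))
      ≡⟨ trans (+-suc ∣ S ∣ _) (cong suc (+-suc ∣ S ∣ _)) ⟩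
    2 + (∣ S ∣ + 2 * numColors (φ ∘ suc))
      ≤⟨ s≤s (s≤s bound) ⟩
    2 + 2 * m
      ≡⟨ sym (*-suc 2 m) ⟩
    2 * suc m ∎

m≤numColors+∣T∣ : (φ : Fin m → ℕ) (T : Subset m) → Repeated φ ⊆ (_∈ T) →
                  m ≤ numColors φ + ∣ T ∣
m≤numColors+∣T∣ {ℕ.zero} φ [] cover = z≤n
m≤numColors+∣T∣ {suc m} φ (outside ∷ T) cover = begin
  suc m                              ≤⟨ s≤s (m≤numColors+∣T∣ (φ ∘ suc) T (⊆-tail cover)) ⟩
  suc (numColors (φ ∘ suc)) + ∣ T ∣  ≡⟨ cong (_+ ∣ T ∣) (numColors-fresh φ (zero-fresh cover)) ⟨
  numColors φ + ∣ T ∣                ∎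
  where open ≤-Reasoning
m≤numColors+∣T∣ {suc m} φ (inside ∷ T) cover with any? (λ y → φ zero ℕ.≟ φ (suc y))
... | yes (_ , φ₀≡φy) = begin
  suc m                              ≤⟨ s≤s (m≤numColors+∣T∣ (φ ∘ suc) T (⊆-tail cover)) ⟩
  suc (numColors (φ ∘ suc) + ∣ T ∣)  ≡⟨ +-suc (numColors (φ ∘ suc)) ∣ T ∣ ⟨
  numColors (φ ∘ suc) + suc ∣ T ∣    ≡⟨ cong (_+ suc ∣ T ∣) (numColors-repeated φ φ₀≡φy) ⟨
  numColors φ + suc ∣ T ∣            ∎
  where open ≤-Reasoning
... | no fresh = begin
  suc m                              ≤⟨ s≤s (m≤numColors+∣T∣ (φ ∘ suc) T (⊆-tail cover)) ⟩
  suc (numColors (φ ∘ suc) + ∣ T ∣)  ≤⟨ s≤s (+-monoʳ-≤ (numColors (φ ∘ suc)) (n≤1+n ∣ T ∣)) ⟩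
  suc (numColors (φ ∘ suc)) + suc ∣ T ∣ ≡⟨ cong (_+ suc ∣ T ∣) (numColors-fresh φ fresh) ⟨
  numColors φ + suc ∣ T ∣            ∎
  where open ≤-Reasoning

m<numColors+∣T∣ : (φ : Fin m → ℕ) (T : Subset m) → Repeated φ ⊆ (_∈ T) → 0 < ∣ T ∣ →
                  m < numColors φ + ∣ T ∣
m<numColors+∣T∣ {ℕ.zero} φ [] cover ()
m<numColors+∣T∣ {suc m} φ (outside ∷ T) cover 0<∣T∣ = begin-strict
  suc m                              <⟨ s≤s (m<numColors+∣T∣ (φ ∘ suc) T (⊆-tail cover) 0<∣T∣) ⟩
  suc (numColors (φ ∘ suc)) + ∣ T ∣  ≡⟨ cong (_+ ∣ T ∣) (numColors-fresh φ (zero-fresh cover)) ⟨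
  numColors φ + ∣ T ∣                ∎
  where open ≤-Reasoning
m<numColors+∣T∣ {suc m} φ (inside ∷ T) cover _ with any? (λ y → φ zero ℕ.≟ φ (suc y))
... | yes (y , φ₀≡φy) with there y∈T ← cover {suc y} (zero , (λ ()) , sym φ₀≡φy) = begin-strict
  suc m                              <⟨ s≤s (m<numColors+∣T∣ (φ ∘ suc) T (⊆-tail cover) 0<∣T∣) ⟩
  suc (numColors (φ ∘ suc) + ∣ T ∣)  ≡⟨ +-suc (numColors (φ ∘ suc)) ∣ T ∣ ⟨
  numColors (φ ∘ suc) + suc ∣ T ∣    ≡⟨ cong (_+ suc ∣ T ∣) (numColors-repeated φ φ₀≡φy) ⟨
  numColors φ + suc ∣ T ∣            ∎
  where
  open ≤-Reasoning
  0<∣T∣ : 0 < ∣ T ∣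
  0<∣T∣ = x∈p⇒0<∣p∣ y∈T
... | no fresh = begin-strict
  suc m                              ≤⟨ s≤s (m≤numColors+∣T∣ (φ ∘ suc) T (⊆-tail cover)) ⟩
  suc (numColors (φ ∘ suc) + ∣ T ∣)  <⟨ s≤s (≤-reflexive (sym (+-suc _ ∣ T ∣))) ⟩
  suc (numColors (φ ∘ suc)) + suc ∣ T ∣ ≡⟨ cong (_+ suc ∣ T ∣) (numColors-fresh φ fresh) ⟨
  numColors φ + suc ∣ T ∣            ∎
  where open ≤-Reasoning

collapse : Subset m → Fin m → ℕ
collapse T x with x ∈? T
... | yes _ = 0
... | no _ = suc (toℕ x)

collapse-∈ : (T : Subset m) → x ∈ T → collapse T x ≡ 0
collapse-∈ {x = x} T x∈T with x ∈? T
... | yes _ = refl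
... | no x∉T = contradiction x∈T x∉T

repeated-collapse⊆ : (T : Subset m) → Repeated (collapse T) ⊆ (_∈ T)
repeated-collapse⊆ T {x} (y , x≢y , φx≡φy) with x ∈? T | y ∈? T
... | yes x∈T | _ = x∈T
... | no _ | yes _ = contradiction φx≡φy λ ()
... | no _ | no _ = contradiction (toℕ-injective (suc-injective φx≡φy)) x≢y

module _ (H : Hypergraph) where

  cColoring-cover⇒2-transversal : {φ : Fin (n H) → ℕ} {S : Subset (n H)} →
    IsCColoring H φ → Repeated φ ⊆ (_∈ S) → Is2Transversal H S
  cColoring-cover⇒2-transversal φ-C cover = All.tabulate λ E∈ → case φ-C E∈ of λ where
    (x , y , x≢y , x∈E , y∈E , φx≡φy) → x≢y⇒x∈p⇒y∈p⇒2≤∣p∣ x≢y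
      (x∈p∩q⁺ (x∈E , cover (y , x≢y , φx≡φy)))
      (x∈p∩q⁺ (y∈E , cover (x , x≢y ∘ sym , sym φx≡φy)))

  2-transversal⇒collapse-cColoring : {T : Subset (n H)} →
    Is2Transversal H T → IsCColoring H (collapse T)
  2-transversal⇒collapse-cColoring {T} T₂ E∈ with 2≤∣p∣⇒∃≢ (All.lookup T₂ E∈)
  ... | x , y , x≢y , x∈E∩T , y∈E∩T with x∈E , x∈T ← x∈p∩q⁻ _ T x∈E∩T
                                     | y∈E , y∈T ← x∈p∩q⁻ _ T y∈E∩T =
    x , y , x≢y , x∈E , y∈E , trans (collapse-∈ T x∈T) (sym (collapse-∈ T y∈T))

  2-transversal⇒2≤∣T∣ : {T : Subset (n H)} → HasEdge H → Is2Transversal H T → 2 ≤ ∣ T ∣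
  2-transversal⇒2≤∣T∣ {T} (E , E∈) T₂ = ≤-trans (All.lookup T₂ E∈) (∣p∩q∣≤∣q∣ E T)

  τ₂≤2*dec : IsDec H d → IsTau2 H t → t ≤ 2 * d
  τ₂≤2*dec (_ , ((φ , φ-C , refl) , _) , refl) (_ , minimal)
    with S , cover , bound ← repeated-cover φ =
    begin
      _                                ≤⟨ minimal S (cColoring-cover⇒2-transversal φ-C cover) ⟩
      ∣ S ∣                            ≤⟨ m+n≤o⇒m≤o∸n ∣ S ∣ bound ⟩
      2 * n H ∸ 2 * numColors φ        ≡⟨ *-distribˡ-∸ 2 (n H) (numColors φ) ⟨
      2 * (n H ∸ numColors φ)          ∎
    where open ≤-Reasoning

  dec<τ₂ : HasEdge H → IsDec H d → IsTau2 H t → d < t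
  dec<τ₂ edge (k , (_ , maximal) , refl) ((T , T₂ , refl) , _) =
    m<n+o⇒m∸n<o (n H) k {{>-nonZero 0<∣T∣}} (begin-strict
      n H
        <⟨ m<numColors+∣T∣ (collapse T) T (repeated-collapse⊆ T) 0<∣T∣ ⟩
      numColors (collapse T) + ∣ T ∣
        ≤⟨ +-monoˡ-≤ ∣ T ∣ (maximal _ (2-transversal⇒collapse-cColoring T₂)) ⟩
      k + ∣ T ∣ ∎)
    where
    open ≤-Reasoning
    0<∣T∣ : 0 < ∣ T ∣
    0<∣T∣ = ≤-trans (s≤s z≤n) (2-transversal⇒2≤∣T∣ edge T₂)

K₂ : Hypergraph
K₂ = record { n = 2 ; edges = ⊤ ∷ [] ; edge≥2 = ≤-refl ∷ [] }

K₂-hasEdge : HasEdge K₂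
K₂-hasEdge = ⊤ , here refl

dec-K₂ : IsDec K₂ 1
dec-K₂ = 1 , ((const0 , const0-C , refl) , atMostOne) , refl
  where
  const0 : Fin 2 → ℕ
  const0 _ = 0
  const0-C : IsCColoring K₂ const0
  const0-C (here refl) = zero , suc zero , (λ ()) , here , there here , refl
  ends-agree : (φ : Fin 2 → ℕ) {x y : Fin 2} → x ≢ y → φ x ≡ φ y → φ zero ≡ φ (suc zero)
  ends-agree φ {zero} {zero} x≢y _ = contradiction refl x≢y
  ends-agree φ {zero} {suc zero} _ φx≡φy = φx≡φy
  ends-agree φ {suc zero} {zero} _ φx≡φy = sym φx≡φy
  ends-agree φ {suc zero} {suc zero} x≢y _ = contradiction refl x≢y
  atMostOne : ∀ φ → IsCColoring K₂ φ → numColors φ ≤ 1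
  atMostOne φ φ-C with x , y , x≢y , _ , _ , φx≡φy ← φ-C (here refl) =
    ≤-reflexive (numColors-repeated φ (ends-agree φ x≢y φx≡φy))

τ₂-K₂ : IsTau2 K₂ 2
τ₂-K₂ = (⊤ , ≤-refl ∷ [] , refl) , λ T T₂ → 2-transversal⇒2≤∣T∣ K₂ K₂-hasEdge T₂

proposition1 : ((H : Hypergraph) → HasEdge H → (d t : ℕ) → IsDec H d → IsTau2 H t →
    (t ≤ 2 * d) × (d < t))
    × (Σ Hypergraph λ H → HasEdge H × Σ ℕ λ d → Σ ℕ λ t →
    IsDec H d × IsTau2 H t × t ≡ 2 * d)
    × (Σ Hypergraph λ H → HasEdge H × Σ ℕ λ d → Σ ℕ λ t →
    IsDec H d × IsTau2 H t × t ≡ suc d)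
proposition1 =
    (λ H edge d t dec τ₂ → τ₂≤2*dec H dec τ₂ , dec<τ₂ H edge dec τ₂)
  , (K₂ , K₂-hasEdge , 1 , 2 , dec-K₂ , τ₂-K₂ , refl)
  , (K₂ , K₂-hasEdge , 1 , 2 , dec-K₂ , τ₂-K₂ , refl)
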